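{- Let $G$ be a 2-connected graph on $n$ vertices and $C$ a locally maximal cycle in $G$ of length $c\leq n-1$. Let $\overline{G}$ be the $C$-closure of $G$. Then $\overline{G}[V(C)]$ is not Hamiltonian-connected.
   Context: Graphs are simple and finite. A cycle $C$ in $G$ is locally maximal if there is no cycle $C'$ in $G$ with $|E(C')|>|E(C)|$ and $|E(C')\cap E(C,G-C)|\leq 2$, where $E(C,G-C)$ is the set of edges with exactly one endpoint in $V(C)$. The $m$-closure of a graph is obtained by recursively joining pairs of nonadjacent vertices whose degree sum is at least $m$ until no such pair remains; the $C$-closure of $G$ is obtained by replacing $G[V(C)]$ by its $(c+1)$-closure. A graph is Hamiltonian-connected if for any two vertices $x,y$ there is an $(x,y)$-path through all vertices. -}

module Defs where

open import Data.Nat using (ℕ; zero; suc; _+_; _≤_; _<_; _∸_)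
open import Data.Bool using (Bool; true; false; _∨_; _xor_; if_then_else_)
open import Data.Fin using (Fin; _≟_)
open import Data.List using (List; []; _∷_; _++_; [_]; length; zip; drop; take; allFin)
open import Data.Bool.ListAction using (any)
open import Data.List.Relation.Unary.Linked using (Linked)
open import Data.List.Relation.Unary.All using (All)
open import Data.List.Relation.Unary.Unique.Propositional using (Unique)
open import Data.List.Membership.Propositional using (_∈_)
open import Data.Product using (Σ; ∃; _×_; _,_)
open import Data.Sum using (_⊎_)
open import Relation.Nullary using (¬_; does)
open import Relation.Binary.PropositionalEquality using (_≡_; _≢_)
open import Relation.Binary.Construct.Closure.ReflexiveTransitive using (Star)
open import Function.Bundles using (_⇔_)

record Graph (n : ℕ) : Set where
  field
    adj    : Fin n → Fin n → Bool
    sym    : ∀ u v → adj u v ≡ adj v u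
    irrefl : ∀ v → adj v v ≡ false
open Graph public

module _ {n : ℕ} where

  Adj : Graph n → Fin n → Fin n → Set
  Adj G u v = adj G u v ≡ true

  countTrue : List Bool → ℕ
  countTrue []          = 0
  countTrue (true ∷ bs) = suc (countTrue bs)
  countTrue (false ∷ bs) = countTrue bs

  Connected : Graph n → Set
  Connected G = ∀ x y → x ≢ y → ∃ λ mid → Linked (Adj G) (x ∷ mid ++ [ y ])

  ConnectedWithout : Graph n → Fin n → Set
  ConnectedWithout G v = ∀ x y → x ≢ v → y ≢ v → x ≢ y →
    ∃ λ mid → All (λ w → w ≢ v) mid × Linked (Adj G) (x ∷ mid ++ [ y ])

  TwoConnected : Graph n → Set
  TwoConnected G = 3 ≤ n × Connected G × (∀ v → ConnectedWithout G v)

  IsCycle : Graph n → List (Fin n) → Set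
  IsCycle G vs = 3 ≤ length vs × Unique vs × Linked (Adj G) (vs ++ take 1 vs)

  cycleEdges : List (Fin n) → List (Fin n × Fin n)
  cycleEdges vs = zip vs (drop 1 vs ++ take 1 vs)

  inV : List (Fin n) → Fin n → Bool
  inV vs v = any (λ u → does (u ≟ v)) vs

  -- |E(C') ∩ E(C, G - C)| : edges of C' with exactly one end in V(C)
  crossCount : List (Fin n) → List (Fin n) → ℕ
  crossCount C C' = countTrue (Data.List.map (λ e → inV C (Data.Product.proj₁ e) xor inV C (Data.Product.proj₂ e)) (cycleEdges C'))

  LocallyMaximal : Graph n → List (Fin n) → Set
  LocallyMaximal G C = IsCycle G C ×
    ¬ (∃ λ C' → IsCycle G C' × length C < length C' × crossCount C C' ≤ 2)

  degIn : Graph n → (Fin n → Bool) → Fin n → ℕ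
  degIn H S v = countTrue (Data.List.map (λ u → if S u then adj H v u else false) (allFin n))

  ClosureStep : ℕ → (Fin n → Bool) → Graph n → Graph n → Set
  ClosureStep m S G H = ∃ λ u → ∃ λ v →
    S u ≡ true × S v ≡ true × u ≢ v × ¬ Adj G u v ×
    m ≤ degIn G S u + degIn G S v ×
    (∀ x y → (Adj H x y ⇔ (Adj G x y ⊎ (x ≡ u × y ≡ v) ⊎ (x ≡ v × y ≡ u))))

  ClosedIn : ℕ → (Fin n → Bool) → Graph n → Set
  ClosedIn m S H = ∀ u v → S u ≡ true → S v ≡ true → u ≢ v → ¬ Adj H u v →
    degIn H S u + degIn H S v < m

  IsClosureIn : ℕ → (Fin n → Bool) → Graph n → Graph n → Set
  IsClosureIn m S G H = Star (ClosureStep m S) G H × ClosedIn m S H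

  IsCClosure : Graph n → List (Fin n) → Graph n → Set
  IsCClosure G C H = IsClosureIn (suc (length C)) (inV C) G H

  HamConnectedIn : Graph n → (Fin n → Bool) → Set
  HamConnectedIn H S = ∀ x y → S x ≡ true → S y ≡ true → x ≢ y →
    ∃ λ mid → let P = x ∷ mid ++ [ y ] in
      Unique P × Linked (Adj H) P × (∀ w → (w ∈ P ⇔ S w ≡ true))

-- Suppose G̅[V(C)] were Hamiltonian-connected. A closure step adds an edge uv inside V(C) with
-- deg u + deg v ≥ c + 1, degrees taken within V(C). A Hamiltonian x–y path of G[V(C)] + uv through
-- uv can be rerouted in G as soon as two consecutive vertices a, b on the same side of uv satisfy
-- ua, vb ∈ E(G): reverse the segment between a and uv (Pósa rotation). If there are none, every
-- consecutive pair a, b contributes [ua] + [vb] ≤ 1 and the pair u, v contributes 0, whence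
-- deg u + deg v ≤ c. Undoing the closure step by step, G[V(C)] is itself Hamiltonian-connected.
-- As c ≤ n - 1 some vertex z lies off C, and 2-connectivity yields an ear of C through z: a path
-- between distinct x, y ∈ V(C) with nonempty interior outside C. A Hamiltonian y–x path of G[V(C)]
-- closes the ear to a cycle longer than C with exactly two edges leaving V(C), contradicting local
-- maximality.

module Submission where

open import Defs hiding (sym)
open import Data.Bool using (Bool; true; false; _xor_; if_then_else_)
import Data.Bool as Bool
open import Data.Bool.Properties using (¬-not; not-¬)
open import Data.Empty using (⊥-elim)
open import Data.Fin using (Fin; _≟_)
open import Data.Fin.Properties using (¬∀⟶∃¬)
open import Data.List using (List; []; _∷_; _++_; [_]; _∷ʳ_; length; map; reverse; reverseAcc; zip)
open import Data.List.Properties using (length-++; length-tabulate; map-++; ++-assoc; ∷-injective; ∷ʳ-injective; unfold-reverse; reverse-++)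
open import Data.List.Membership.Propositional using (_∈_; _∉_)
open import Data.List.Membership.Propositional.Properties using (∈-∃++; ∈-++⁻; ∈-++⁺ˡ; ∈-++⁺ʳ)
open import Data.List.Relation.Binary.Permutation.Propositional using (_↭_; prep; ↭-sym; ↭⇒↭ₛ)
open import Data.List.Relation.Binary.Permutation.Propositional.Properties using (++⁺ˡ; ++⁺ʳ; ↭-reverse; ∈-resp-↭)
open import Data.List.Relation.Binary.Permutation.Setoid.Properties using (Unique-resp-↭)
open import Data.List.Relation.Unary.All as All using (All; []; _∷_)
import Data.List.Relation.Unary.All.Properties as Allₚ
open import Data.List.Relation.Binary.Subset.Propositional using (_⊆_)
open import Data.List.Relation.Binary.Subset.Propositional.Properties using (∷⁺ʳ)
import Data.List.Membership.DecPropositional as DecMembership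
open import Data.List.Relation.Unary.Any using (here; there)
open import Data.List.Relation.Unary.Linked as Linked using (Linked; []; [-]; _∷_)
open import Data.List.Relation.Unary.AllPairs as AllPairs using ([]; _∷_)
open import Data.List.Relation.Unary.Unique.Propositional using (Unique)
open import Data.List.Relation.Unary.Unique.Propositional.Properties as Unique using (allFin⁺)
open import Data.Nat using (ℕ; suc; _+_; _≤_; _<_; _∸_; z≤n; s≤s; z<s)
open import Data.Nat.Properties using (≤-<-trans; ∸-monoʳ-<; ≤-refl; m≤n+m; +-assoc; +-monoˡ-≤; <-≤-trans; ≤-trans; ≤-reflexive; +-comm; +-identityʳ; +-suc; <-irrefl; +-mono-≤; +-monoʳ-≤; m≤m+n; n≤1+n)
open import Data.Nat.Solver using (module +-*-Solver)
open import Data.Product using (∃; ∃₂; _×_; _,_; proj₁; proj₂)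
open import Data.Sum using (_⊎_; inj₁; inj₂; [_,_]′)
open import Function using (_∘_; _⇔_; mk⇔; Equivalence)
open Equivalence using (to; from)
open import Relation.Binary using (Rel; Symmetric; DecidableEquality)
open import Relation.Binary.PropositionalEquality
  using (_≡_; _≢_; refl; sym; trans; cong; subst; subst₂; setoid)
open import Relation.Binary.Construct.Closure.ReflexiveTransitive using (Star; ε; _◅_)
open import Relation.Nullary using (¬_; yes; no)

module _ {ℓ} {A : Set ℓ} where

  last : A → List A → A
  last x []       = x
  last _ (y ∷ ys) = last y ys

  last-++ : ∀ (x : A) xs y ys → last x (xs ++ y ∷ ys) ≡ last y ys
  last-++ x []       y ys = refl
  last-++ x (z ∷ xs) y ys = last-++ z xs y ys

  ∷ʳ-uncons : ∀ xs (x : A) → ∃₂ λ y ys → xs ++ [ x ] ≡ y ∷ ys × last y ys ≡ x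
  ∷ʳ-uncons []       x = x , [] , refl , refl
  ∷ʳ-uncons (y ∷ xs) x = y , xs ++ [ x ] , refl , last-++ y xs x []

  split-before : ∀ {x : A} {xs} ps {a b qs} → x ∷ xs ≡ ps ++ a ∷ b ∷ qs → ∃ λ zs → xs ≡ zs ++ b ∷ qs × last x zs ≡ a
  split-before []       refl = [] , refl , refl
  split-before (_ ∷ ps) {a} {b} {qs} refl = ps ++ [ a ] , sym (++-assoc ps [ a ] (b ∷ qs)) , last-++ _ ps a []

  reverse-∷ : ∀ (x : A) xs → ∃ λ ws → reverse (x ∷ xs) ≡ last x xs ∷ ws
  reverse-∷ x []       = [] , refl
  reverse-∷ x (y ∷ ys) with ws , eq ← reverse-∷ y ys =
    ws ∷ʳ x , trans (unfold-reverse x (y ∷ ys)) (cong (_∷ʳ x) eq)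

  reverse-∷-∷ʳ : ∀ (x : A) xs y → reverse (x ∷ xs ++ [ y ]) ≡ y ∷ reverse xs ++ [ x ]
  reverse-∷-∷ʳ x xs y = trans (unfold-reverse x (xs ++ [ y ])) (cong (_∷ʳ x) (reverse-++ xs [ y ]))

  ++-∷-nonEmpty : ∀ (xs : List A) z zs → ∃₂ λ w ws → xs ++ z ∷ zs ≡ w ∷ ws
  ++-∷-nonEmpty []       z zs = z , zs , refl
  ++-∷-nonEmpty (x ∷ xs) z zs = x , xs ++ z ∷ zs , refl

  Unique-++⁻ˡ : ∀ xs {ys : List A} → Unique (xs ++ ys) → Unique xs
  Unique-++⁻ˡ []       _        = []
  Unique-++⁻ˡ (x ∷ xs) (px ∷ u) = Allₚ.++⁻ˡ xs px ∷ Unique-++⁻ˡ xs u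

  Unique-++⁻ʳ : ∀ xs {ys : List A} → Unique (xs ++ ys) → Unique ys
  Unique-++⁻ʳ []       u       = u
  Unique-++⁻ʳ (x ∷ xs) (_ ∷ u) = Unique-++⁻ʳ xs u

  ∈-++-∷⁻ : ∀ {x y : A} xs {ys} → x ∈ xs ++ y ∷ ys → x ≢ y → x ∈ xs ++ ys
  ∈-++-∷⁻ xs x∈ x≢y with ∈-++⁻ xs x∈
  ... | inj₁ x∈xs         = ∈-++⁺ˡ x∈xs
  ... | inj₂ (here x≡y)   = ⊥-elim (x≢y x≡y)
  ... | inj₂ (there x∈ys) = ∈-++⁺ʳ xs x∈ys

  Ends : A → A → List A → Set ℓ
  Ends x y xs = ∃ λ mid → xs ≡ x ∷ mid ++ [ y ]

  private
    Ends-replaceInit : ∀ (xs : List A) z zs {mid y} → xs ++ z ∷ zs ≡ mid ++ [ y ] →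
      ∀ xs′ → ∃ λ mid′ → xs′ ++ z ∷ zs ≡ mid′ ++ [ y ]
    Ends-replaceInit xs z [] eq xs′ = xs′ , cong (λ t → xs′ ++ [ t ]) (proj₂ (∷ʳ-injective xs _ eq))
    Ends-replaceInit xs z (z′ ∷ zs) eq xs′
      with mid′ , eq′ ← Ends-replaceInit (xs ++ [ z ]) z′ zs (trans (++-assoc xs [ z ] _) eq) (xs′ ++ [ z ]) =
      mid′ , trans (sym (++-assoc xs′ [ z ] _)) eq′

  Ends-replaceInner : ∀ (xs : List A) a ms ms′ b zs {x y} →
    Ends x y (xs ++ a ∷ ms ++ b ∷ zs) → Ends x y (xs ++ a ∷ ms′ ++ b ∷ zs)
  Ends-replaceInner [] a ms ms′ b zs (mid , eq) with refl , eq′ ← ∷-injective eq =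
    let mid′ , eq″ = Ends-replaceInit ms b zs eq′ ms′ in mid′ , cong (a ∷_) eq″
  Ends-replaceInner (c ∷ xs) a ms ms′ b zs (mid , eq) with refl , eq′ ← ∷-injective eq =
    let mid′ , eq″ = Ends-replaceInit (xs ++ a ∷ ms) b zs (trans (++-assoc xs (a ∷ ms) _) eq′) (xs ++ a ∷ ms′)
    in  mid′ , cong (c ∷_) (trans (sym (++-assoc xs (a ∷ ms′) _)) eq″)

another : ∀ {ℓ p} {A : Set ℓ} {P : A → Set p} → DecidableEquality A →
  ∀ {c c′} → P c → P c′ → c ≢ c′ → ∀ x → ∃ λ y → P y × y ≢ x
another _≟_ {c} Pc Pc′ c≢c′ x with x ≟ c
... | yes refl = _ , Pc′ , c≢c′ ∘ sym
... | no x≢c   = c , Pc , x≢c ∘ sym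

twoDistinct : ∀ {ℓ} {A : Set ℓ} {xs : List A} → 2 ≤ length xs → Unique xs → ∃₂ λ x y → x ∈ xs × y ∈ xs × x ≢ y
twoDistinct {xs = _ ∷ []}    (s≤s ()) _
twoDistinct {xs = x ∷ y ∷ _} _        ((x≢y ∷ _) ∷ _) = x , y , here refl , there (here refl) , x≢y

in≢out : ∀ {ℓ} {A : Set ℓ} (S : A → Bool) {a b} → S a ≡ true → S b ≡ false → a ≢ b
in≢out S Sa Sb refl = not-¬ Sa Sb

module _ {ℓ r} {A : Set ℓ} {R : Rel A r} where

  Linked-++⁻ˡ : ∀ xs {ys : List A} → Linked R (xs ++ ys) → Linked R xs
  Linked-++⁻ˡ []           _       = []
  Linked-++⁻ˡ (_ ∷ [])     _       = [-]
  Linked-++⁻ˡ (_ ∷ y ∷ xs) (r ∷ l) = r ∷ Linked-++⁻ˡ (y ∷ xs) l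

  Linked-split : ∀ xs {x : A} {ys} → Linked R (xs ++ x ∷ ys) → Linked R (xs ++ [ x ]) × Linked R (x ∷ ys)
  Linked-split []           l       = [-] , l
  Linked-split (_ ∷ [])     (r ∷ l) = r ∷ [-] , l
  Linked-split (_ ∷ y ∷ xs) (r ∷ l) with l₁ , l₂ ← Linked-split (y ∷ xs) l = r ∷ l₁ , l₂

  Linked-glue : ∀ xs {x : A} {ys} → Linked R (xs ++ [ x ]) → Linked R (x ∷ ys) → Linked R (xs ++ x ∷ ys)
  Linked-glue []           _       l = l
  Linked-glue (_ ∷ [])     (r ∷ _) l = r ∷ l
  Linked-glue (_ ∷ y ∷ xs) (r ∷ l₁) l = r ∷ Linked-glue (y ∷ xs) l₁ l

  module _ (R-sym : Symmetric R) where

    private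
      Linked-reverseAcc : ∀ {x} acc xs → Linked R (x ∷ acc) → Linked R (x ∷ xs) → Linked R (reverseAcc (x ∷ acc) xs)
      Linked-reverseAcc acc []       l _       = l
      Linked-reverseAcc acc (_ ∷ xs) l (r ∷ k) = Linked-reverseAcc (_ ∷ acc) xs (R-sym r ∷ l) k

    Linked-reverse : ∀ {xs} → Linked R xs → Linked R (reverse xs)
    Linked-reverse {[]}     _ = []
    Linked-reverse {_ ∷ xs} l = Linked-reverseAcc [] xs [-] l

    Linked-reverseWalk : ∀ {x} xs {y} → Linked R (x ∷ xs ++ [ y ]) → Linked R (y ∷ reverse xs ++ [ x ])
    Linked-reverseWalk xs l = subst (Linked R) (reverse-∷-∷ʳ _ xs _) (Linked-reverse l)

    Linked-reverseBlock : ∀ xs {x y ys z zs} → Linked R (xs ++ [ x ]) → Linked R (y ∷ ys) → Linked R (z ∷ zs) →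
      R x (last y ys) → R y z → Linked R (xs ++ x ∷ reverse (y ∷ ys) ++ z ∷ zs)
    Linked-reverseBlock xs {x} {y} {ys} {z} {zs} lxs lys lzs x~last y~z with ws , eq ← reverse-∷ y ys =
      Linked-glue xs lxs
        (subst (λ t → Linked R (x ∷ t ++ z ∷ zs)) (sym eq) (x~last ∷ subst (λ t → Linked R (t ++ z ∷ zs)) eq block))
      where
      block : Linked R (reverse (y ∷ ys) ++ z ∷ zs)
      block = subst (Linked R)
        (trans (sym (++-assoc (reverse ys) [ y ] (z ∷ zs))) (cong (_++ z ∷ zs) (sym (unfold-reverse y ys))))
        (Linked-glue (reverse ys) (subst (Linked R) (unfold-reverse y ys) (Linked-reverse lys)) (y~z ∷ lzs))

  Linked-firstEntry : ∀ (S : A → Bool) a L b → S b ≡ true → Linked R (a ∷ L ++ [ b ]) →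
    ∃₂ λ pre y → S y ≡ true × y ∈ L ++ [ b ] × All (λ w → S w ≡ false) pre × Linked R (a ∷ pre ++ [ y ])
  Linked-firstEntry S a []      b Sb l       = [] , b , Sb , here refl , [] , l
  Linked-firstEntry S a (d ∷ L) b Sb (r ∷ l) with S d in Sd
  ... | true  = [] , d , Sd , here refl , [] , r ∷ [-]
  ... | false =
    let pre , y , Sy , y∈ , out , l′ = Linked-firstEntry S d L b Sb l
    in  d ∷ pre , y , Sy , there y∈ , Sd ∷ out , r ∷ l′

  -- Shortcut the tail first; if a then reappears on it, drop everything up to that occurrence.
  Linked-shortcut : DecidableEquality A → ∀ a L b → a ≢ b → Linked R (a ∷ L ++ [ b ]) →
    ∃ λ L′ → Linked R (a ∷ L′ ++ [ b ]) × Unique (a ∷ L′ ++ [ b ]) × L′ ⊆ L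
  Linked-shortcut _≟_ a []      b a≢b l = [] , l , (a≢b ∷ []) ∷ [] ∷ [] , λ ()
  Linked-shortcut _≟_ a (d ∷ L) b a≢b (r ∷ l) with d ≟ b
  ... | yes refl = [] , r ∷ [-] , (a≢b ∷ []) ∷ [] ∷ [] , λ ()
  ... | no d≢b with Linked-shortcut _≟_ d L b d≢b l
  ...   | L′ , l′ , u′ , L′⊆L with DecMembership._∈?_ _≟_ a (d ∷ L′)
  ...     | no a∉ = d ∷ L′ , r ∷ l′ , Allₚ.¬Any⇒All¬ _ a∉′ ∷ u′ , ∷⁺ʳ d L′⊆L
    where
    a∉′ : a ∉ d ∷ L′ ++ [ b ]
    a∉′ a∈ with ∈-++⁻ (d ∷ L′) a∈
    ... | inj₁ a∈dL′    = a∉ a∈dL′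
    ... | inj₂ (here a≡b) = a≢b a≡b
  ...     | yes a∈ with ps , qs , eq ← ∈-∃++ a∈ =
    qs , proj₂ (Linked-split ps (subst (Linked R) eq′ l′)) , Unique-++⁻ʳ ps (subst Unique eq′ u′) ,
    ∷⁺ʳ d L′⊆L ∘ subst (_ ∈_) (sym eq) ∘ ∈-++⁺ʳ ps ∘ there
    where
    eq′ : d ∷ L′ ++ [ b ] ≡ ps ++ a ∷ qs ++ [ b ]
    eq′ = trans (cong (_++ [ b ]) eq) (++-assoc ps (a ∷ qs) [ b ])

module _ {n : ℕ} where

  countTrue-++ : ∀ xs ys → countTrue {n} (xs ++ ys) ≡ countTrue {n} xs + countTrue {n} ys
  countTrue-++ []           ys = refl
  countTrue-++ (true ∷ xs)  ys = cong suc (countTrue-++ xs ys)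
  countTrue-++ (false ∷ xs) ys = countTrue-++ xs ys

  countTrue-map-remove : ∀ {A : Set} (f : A → Bool) xs {x} ys → f x ≡ true →
    countTrue {n} (map f (xs ++ x ∷ ys)) ≡ suc (countTrue {n} (map f (xs ++ ys)))
  countTrue-map-remove f [] ys fx rewrite fx = refl
  countTrue-map-remove f (z ∷ xs) ys fx with f z
  ... | true  = cong suc (countTrue-map-remove f xs ys fx)
  ... | false = countTrue-map-remove f xs ys fx

  countTrue-map-mono : ∀ {A : Set} (f g : A → Bool) {xs ys} → Unique xs →
    (∀ {x} → x ∈ xs → f x ≡ true → x ∈ ys × g x ≡ true) →
    countTrue {n} (map f xs) ≤ countTrue {n} (map g ys)
  countTrue-map-mono f g {[]}     _          _   = z≤n
  countTrue-map-mono f g {x ∷ xs} (x∉ ∷ uxs) sub with f x in fx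
  ... | false = countTrue-map-mono f g uxs (sub ∘ there)
  ... | true with x∈ys , gx ← sub (here refl) fx | ∈-∃++ x∈ys
  ...   | ps , qs , refl = subst (suc (countTrue {n} (map f xs)) ≤_) (sym (countTrue-map-remove g ps qs gx))
    (s≤s (countTrue-map-mono f g uxs λ y∈ fy →
      let y∈ys , gy = sub (there y∈) fy in ∈-++-∷⁻ ps y∈ys (λ { refl → All.lookup x∉ y∈ refl }) , gy))

  countTrue-map-true : ∀ {A : Set} (xs : List A) → countTrue {n} (map (λ _ → true) xs) ≡ length xs
  countTrue-map-true []       = refl
  countTrue-map-true (_ ∷ xs) = cong suc (countTrue-map-true xs)

  inV⁻ : ∀ (C : List (Fin n)) {v} → inV C v ≡ true → v ∈ C
  inV⁻ (c ∷ C) {v} eq with c ≟ v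
  ... | yes refl = here refl
  ... | no  _    = there (inV⁻ C eq)

  inV⁺ : ∀ (C : List (Fin n)) {v} → v ∈ C → inV C v ≡ true
  inV⁺ (c ∷ C) {v} v∈ with c ≟ v | v∈
  ... | yes _   | _         = refl
  ... | no  c≢v | here v≡c  = ⊥-elim (c≢v (sym v≡c))
  ... | no  _   | there v∈C = inV⁺ C v∈C

-- countTrue carries a spurious implicit n from Defs, so any value will do here.
length-mono-Unique : ∀ {A : Set} {xs ys : List A} → Unique xs → xs ⊆ ys → length xs ≤ length ys
length-mono-Unique {xs = xs} {ys} uxs xs⊆ys =
  subst₂ _≤_ (countTrue-map-true {0} xs) (countTrue-map-true {0} ys)
    (countTrue-map-mono {0} (λ _ → true) (λ _ → true) uxs λ x∈ _ → xs⊆ys x∈ , refl)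

outsideVertex : ∀ {n} (C : List (Fin n)) → length C < n → ∃ λ z → inV C z ≡ false
outsideVertex {n} C c<n =
  let z , z∉C = ¬∀⟶∃¬ n (λ z → inV C z ≡ true) (λ z → inV C z Bool.≟ true) allInside⇒n≤c in z , ¬-not z∉C
  where
  allInside⇒n≤c : ¬ (∀ z → inV C z ≡ true)
  allInside⇒n≤c allInside = <-irrefl refl (<-≤-trans c<n
    (subst (_≤ length C) (length-tabulate (λ z → z)) (length-mono-Unique (allFin⁺ n) λ {z} _ → inV⁻ C (allInside z))))

-- Hamiltonian paths and Pósa rotation

module _ {n : ℕ} where

  Spans : (Fin n → Bool) → List (Fin n) → Set
  Spans S P = Unique P × (∀ w → w ∈ P ⇔ S w ≡ true)

  HamPath : Graph n → (Fin n → Bool) → List (Fin n) → Set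
  HamPath H S P = Linked (Adj H) P × Spans S P

  HamPathBetween : Graph n → (Fin n → Bool) → Fin n → Fin n → Set
  HamPathBetween H S x y = ∃ λ P → Ends x y P × HamPath H S P

  Spans-resp-↭ : ∀ {S P Q} → P ↭ Q → Spans S P → Spans S Q
  Spans-resp-↭ P↭Q (uP , memP) =
    Unique-resp-↭ (setoid (Fin n)) (↭⇒↭ₛ P↭Q) uP ,
    λ w → mk⇔ (to (memP w) ∘ ∈-resp-↭ (↭-sym P↭Q)) (∈-resp-↭ P↭Q ∘ from (memP w))

  degIn≤ : ∀ G S u {P} → Spans S P → degIn G S u ≤ countTrue {n} (map (adj G u) P)
  degIn≤ G S u {P} (_ , memP) = countTrue-map-mono {n} _ (adj G u) (allFin⁺ n) λ {w} _ → inside w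
    where
    inside : ∀ w → (if S w then adj G u w else false) ≡ true → w ∈ P × adj G u w ≡ true
    inside w with S w in Sw
    ... | true  = λ u~w → from (memP w) Sw , u~w
    ... | false = λ ()

  Adj-sym : ∀ (G : Graph n) {x y} → Adj G x y → Adj G y x
  Adj-sym G {x} {y} = trans (Graph.sym G y x)

indicator : Bool → ℕ
indicator true  = 1
indicator false = 0

indicator≤1 : ∀ b → indicator b ≤ 1
indicator≤1 true  = s≤s z≤n
indicator≤1 false = z≤n

both-or-indicator+indicator≤1 : ∀ a b → (a ≡ true × b ≡ true) ⊎ indicator a + indicator b ≤ 1
both-or-indicator+indicator≤1 true  true  = inj₁ (refl , refl)
both-or-indicator+indicator≤1 true  false = inj₂ (s≤s z≤n)
both-or-indicator+indicator≤1 false b     = inj₂ (indicator≤1 b)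

m+i≤1+m : ∀ m {i} → i ≤ 1 → m + i ≤ suc m
m+i≤1+m m {i} i≤1 = subst (m + i ≤_) (+-comm m 1) (+-monoʳ-≤ m i≤1)

reverseBlock : ∀ {n} (G : Graph n) {S} xs a y ys b zs {x x′} →
  Ends x x′ (xs ++ a ∷ (y ∷ ys) ++ b ∷ zs) → Spans S (xs ++ a ∷ (y ∷ ys) ++ b ∷ zs) →
  Linked (Adj G) (xs ++ [ a ]) → Linked (Adj G) (y ∷ ys) → Linked (Adj G) (b ∷ zs) →
  Adj G a (last y ys) → Adj G y b → HamPathBetween G S x x′
reverseBlock G xs a y ys b zs ends spans lxs lys lzs a~ y~b =
  xs ++ a ∷ reverse (y ∷ ys) ++ b ∷ zs ,
  Ends-replaceInner xs a (y ∷ ys) (reverse (y ∷ ys)) b zs ends ,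
  Linked-reverseBlock (Adj-sym G) xs lxs lys lzs a~ y~b ,
  Spans-resp-↭ (↭-sym (++⁺ˡ xs (prep a (++⁺ʳ (b ∷ zs) (↭-reverse (y ∷ ys)))))) spans

module Rotation {n} (G : Graph n) (u v : Fin n) where

  weight : List (Fin n) → ℕ
  weight []      = 0
  weight (w ∷ l) = indicator (adj G u w) + indicator (adj G v w) + weight l

  weight-++ : ∀ xs ys → weight (xs ++ ys) ≡ weight xs + weight ys
  weight-++ []       ys = refl
  weight-++ (w ∷ xs) ys rewrite weight-++ xs ys =
    sym (+-assoc (indicator (adj G u w) + indicator (adj G v w)) (weight xs) (weight ys))

  countTrue+countTrue≡weight : ∀ l → countTrue {n} (map (adj G u) l) + countTrue {n} (map (adj G v) l) ≡ weight l
  countTrue+countTrue≡weight []      = refl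
  countTrue+countTrue≡weight (w ∷ l) with adj G u w | adj G v w
  ... | true  | true  = cong suc (trans (+-suc _ _) (cong suc (countTrue+countTrue≡weight l)))
  ... | true  | false = cong suc (countTrue+countTrue≡weight l)
  ... | false | true  = trans (+-suc _ _) (cong suc (countTrue+countTrue≡weight l))
  ... | false | false = countTrue+countTrue≡weight l

  degIn+degIn≤weight : ∀ {S P} → Spans S P → degIn G S u + degIn G S v ≤ weight P
  degIn+degIn≤weight {S} {P} spans = ≤-trans (+-mono-≤ (degIn≤ G S u spans) (degIn≤ G S v spans))
    (≤-reflexive (countTrue+countTrue≡weight P))

  RotationPair : List (Fin n) → Set
  RotationPair l = ∃₂ λ xs a → ∃₂ λ b ys → l ≡ xs ++ a ∷ b ∷ ys × Adj G u a × Adj G v b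

  private
    weight-step : ∀ i j d k L {c} → i + j ≤ 1 → c ≤ k + L + j → i + d + c ≤ suc k + L + d
    weight-step i j d k L {c} i+j≤1 c≤ = begin
      i + d + c             ≤⟨ +-monoʳ-≤ (i + d) c≤ ⟩
      i + d + (k + L + j)   ≡⟨ solve 5 (λ i j d k L → i :+ d :+ (k :+ L :+ j) := i :+ j :+ (k :+ L :+ d)) refl i j d k L ⟩
      i + j + (k + L + d)   ≤⟨ +-monoˡ-≤ (k + L + d) i+j≤1 ⟩
      suc k + L + d         ∎
      where
      open Data.Nat.Properties.≤-Reasoning
      open +-*-Solver

  -- Without a rotation pair every consecutive pair a, b contributes [ua] + [vb] ≤ 1,
  -- leaving only [u ~ last] and [v ~ first] unpaired.
  rotationPair-or-weight≤ : ∀ a l → RotationPair (a ∷ l) ⊎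
    weight (a ∷ l) ≤ length l + indicator (adj G u (last a l)) + indicator (adj G v a)
  rotationPair-or-weight≤ a []      = inj₂ (≤-reflexive (+-identityʳ _))
  rotationPair-or-weight≤ a (b ∷ l) with rotationPair-or-weight≤ b l
  ... | inj₁ (xs , c , d , ys , eq , u~c , v~d) = inj₁ (a ∷ xs , c , d , ys , cong (a ∷_) eq , u~c , v~d)
  ... | inj₂ bound with both-or-indicator+indicator≤1 (adj G u a) (adj G v b)
  ...   | inj₁ (u~a , v~b) = inj₁ ([] , a , b , l , refl , u~a , v~b)
  ...   | inj₂ i+j≤1 = inj₂ (weight-step _ _ _ (length l) _ i+j≤1 bound)

  rotationPair-or-weight≤-ending : ∀ xs → RotationPair (xs ++ [ u ]) ⊎ weight (xs ++ [ u ]) ≤ length (xs ++ [ u ])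
  rotationPair-or-weight≤-ending xs with ∷ʳ-uncons xs u
  ... | a , l , eq , last≡u rewrite eq with rotationPair-or-weight≤ a l
  ...   | inj₁ pair = inj₁ pair
  ...   | inj₂ bound rewrite last≡u | Graph.irrefl G u | +-identityʳ (length l) =
    inj₂ (≤-trans bound (m+i≤1+m (length l) (indicator≤1 (adj G v a))))

  rotationPair-or-weight≤-starting : ∀ ys → RotationPair (v ∷ ys) ⊎ weight (v ∷ ys) ≤ length (v ∷ ys)
  rotationPair-or-weight≤-starting ys with rotationPair-or-weight≤ v ys
  ... | inj₁ pair = inj₁ pair
  ... | inj₂ bound rewrite Graph.irrefl G v | +-identityʳ (length ys + indicator (adj G u (last v ys))) =
    inj₂ (≤-trans bound (m+i≤1+m (length ys) (indicator≤1 (adj G u (last v ys)))))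

  weight≤length : ∀ xs ys → weight (xs ++ [ u ]) ≤ length (xs ++ [ u ]) → weight (v ∷ ys) ≤ length (v ∷ ys) →
    weight (xs ++ u ∷ v ∷ ys) ≤ length (xs ++ u ∷ v ∷ ys)
  weight≤length xs ys bound₁ bound₂ = begin
    weight (xs ++ u ∷ v ∷ ys)                  ≡⟨ cong weight P≡ ⟩
    weight ((xs ++ [ u ]) ++ v ∷ ys)           ≡⟨ weight-++ (xs ++ [ u ]) (v ∷ ys) ⟩
    weight (xs ++ [ u ]) + weight (v ∷ ys)     ≤⟨ +-mono-≤ bound₁ bound₂ ⟩
    length (xs ++ [ u ]) + length (v ∷ ys)     ≡⟨ sym (length-++ (xs ++ [ u ])) ⟩
    length ((xs ++ [ u ]) ++ v ∷ ys)           ≡⟨ cong length (sym P≡) ⟩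
    length (xs ++ u ∷ v ∷ ys)                  ∎
    where
    open Data.Nat.Properties.≤-Reasoning
    P≡ : xs ++ u ∷ v ∷ ys ≡ (xs ++ [ u ]) ++ v ∷ ys
    P≡ = sym (++-assoc xs [ u ] (v ∷ ys))

  rotate : ∀ {S} xs ys {x y} → Ends x y (xs ++ u ∷ v ∷ ys) → Spans S (xs ++ u ∷ v ∷ ys) →
    Linked (Adj G) (xs ++ [ u ]) → Linked (Adj G) (v ∷ ys) →
    length (xs ++ u ∷ v ∷ ys) < degIn G S u + degIn G S v → HamPathBetween G S x y
  rotate xs ys ends spans lxs lys long
    with rotationPair-or-weight≤-ending xs | rotationPair-or-weight≤-starting ys
  ... | inj₁ (ps , a , b , qs , eq , u~a , v~b) | _ =
    reverseBlock G ps a b qs v ys (subst (Ends _ _) P≡ ends) (subst (Spans _) P≡ spans)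
      (proj₁ split) (Linked.tail (proj₂ split)) lys (subst (Adj G a) (sym last≡u) (Adj-sym G u~a)) (Adj-sym G v~b)
    where
    P≡ : xs ++ u ∷ v ∷ ys ≡ ps ++ a ∷ (b ∷ qs) ++ v ∷ ys
    P≡ = trans (sym (++-assoc xs [ u ] (v ∷ ys))) (trans (cong (_++ v ∷ ys) eq) (++-assoc ps (a ∷ b ∷ qs) (v ∷ ys)))
    split : Linked (Adj G) (ps ++ [ a ]) × Linked (Adj G) (a ∷ b ∷ qs)
    split = Linked-split ps (subst (Linked (Adj G)) eq lxs)
    last≡u : last b qs ≡ u
    last≡u = trans (sym (last-++ u ps a (b ∷ qs))) (trans (cong (last u) (sym eq)) (last-++ u xs u []))
  ... | inj₂ bound₁ | inj₂ bound₂ =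
    ⊥-elim (<-irrefl refl (<-≤-trans long (≤-trans (degIn+degIn≤weight spans) (weight≤length xs ys bound₁ bound₂))))
  ... | inj₂ _ | inj₁ (ps , a , b , qs , eq , u~a , v~b) with split-before ps eq
  ...   | zs , ys≡ , last≡a =
    reverseBlock G xs u v zs b qs (subst (Ends _ _) P≡ ends) (subst (Spans _) P≡ spans)
      lxs (Linked-++⁻ˡ (v ∷ zs) lvzs) (proj₂ (Linked-split (v ∷ zs) lvzs)) (subst (Adj G u) (sym last≡a) u~a) v~b
    where
    P≡ : xs ++ u ∷ v ∷ ys ≡ xs ++ u ∷ (v ∷ zs) ++ b ∷ qs
    P≡ = cong (λ t → xs ++ u ∷ v ∷ t) ys≡
    lvzs : Linked (Adj G) (v ∷ zs ++ b ∷ qs)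
    lvzs = subst (λ t → Linked (Adj G) (v ∷ t)) ys≡ lys

-- Undoing the closure

Joins : ∀ {n} → Fin n → Fin n → Fin n → Fin n → Set
Joins u v a b = (a ≡ u × b ≡ v) ⊎ (a ≡ v × b ≡ u)

module _ {n} {u v : Fin n} where

  Joins-endpoint : ∀ {a b} → Joins u v a b → a ≡ u ⊎ a ≡ v
  Joins-endpoint (inj₁ (a≡u , _)) = inj₁ a≡u
  Joins-endpoint (inj₂ (a≡v , _)) = inj₂ a≡v

  Joins-hits : ∀ {w a b} → w ≡ u ⊎ w ≡ v → Joins u v a b → w ≡ a ⊎ w ≡ b
  Joins-hits (inj₁ refl) (inj₁ (refl , _)) = inj₁ refl
  Joins-hits (inj₁ refl) (inj₂ (_ , refl)) = inj₂ refl
  Joins-hits (inj₂ refl) (inj₁ (_ , refl)) = inj₂ refl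
  Joins-hits (inj₂ refl) (inj₂ (refl , _)) = inj₁ refl

  Joins-degIn : ∀ G S {a b} → Joins u v a b → degIn G S a + degIn G S b ≡ degIn G S u + degIn G S v
  Joins-degIn G S (inj₁ (refl , refl)) = refl
  Joins-degIn G S (inj₂ (refl , refl)) = +-comm (degIn G S v) (degIn G S u)

module _ {n} (G H : Graph n) {u v : Fin n} (edges : ∀ x y → (Adj H x y ⇔ (Adj G x y ⊎ Joins u v x y))) where

  Linked-firstNewEdge : ∀ {l} → Linked (Adj H) l → Linked (Adj G) l ⊎
    ∃₂ λ xs ys → ∃₂ λ a b → l ≡ xs ++ a ∷ b ∷ ys × Joins u v a b × Linked (Adj G) (xs ++ [ a ]) × Linked (Adj H) (b ∷ ys)
  Linked-firstNewEdge []  = inj₁ []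
  Linked-firstNewEdge [-] = inj₁ [-]
  Linked-firstNewEdge {a ∷ b ∷ l} (r ∷ rs) with to (edges a b) r
  ... | inj₂ new = inj₂ ([] , l , a , b , refl , new , [-] , rs)
  ... | inj₁ a~b with Linked-firstNewEdge rs
  ...   | inj₁ lG = inj₁ (a~b ∷ lG)
  ...   | inj₂ (xs , ys , c , d , eq , new , lxs , lys) =
    inj₂ (a ∷ xs , ys , c , d , cong (a ∷_) eq , new , prepend xs eq lxs , lys)
    where
    prepend : ∀ xs → b ∷ l ≡ xs ++ c ∷ d ∷ ys → Linked (Adj G) (xs ++ [ c ]) → Linked (Adj G) (a ∷ xs ++ [ c ])
    prepend []      refl _   = a~b ∷ [-]
    prepend (_ ∷ _) refl lxs = a~b ∷ lxs

  Linked-avoiding : ∀ {w l} → w ≡ u ⊎ w ≡ v → All (w ≢_) l → Linked (Adj H) l → Linked (Adj G) l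
  Linked-avoiding w∈ _                  []       = []
  Linked-avoiding w∈ _                  [-]      = [-]
  Linked-avoiding w∈ (w≢a ∷ w≢b ∷ w≢ls) (r ∷ rs) with to (edges _ _) r
  ... | inj₁ a~b = a~b ∷ Linked-avoiding w∈ (w≢b ∷ w≢ls) rs
  ... | inj₂ new = ⊥-elim ([ w≢a , w≢b ]′ (Joins-hits w∈ new))

unclose-step : ∀ {n m S} {G H : Graph n} → (∀ {P} → Spans S P → length P < m) → ClosureStep m S G H →
  ∀ {x y} → HamPathBetween H S x y → HamPathBetween G S x y
unclose-step {m = m} {S} {G} {H} short (u , v , _ , _ , _ , _ , m≤deg , edges) (P , ends , linked , spans)
  with Linked-firstNewEdge G H edges linked
... | inj₁ linkedG = P , ends , linkedG , spans
... | inj₂ (xs , ys , a , b , refl , new , lxs , lys) =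
  Rotation.rotate G a b xs ys ends spans lxs
    (Linked-avoiding G H edges (Joins-endpoint new) (AllPairs.head (Unique-++⁻ʳ xs (proj₁ spans))) lys)
    (<-≤-trans (short spans) (subst (m ≤_) (sym (Joins-degIn G S new)) m≤deg))

unclose : ∀ {n m S} {G H : Graph n} → (∀ {P} → Spans S P → length P < m) → Star (ClosureStep m S) G H →
  ∀ {x y} → HamPathBetween H S x y → HamPathBetween G S x y
unclose short ε path = path
unclose {G = G} short (_◅_ {j = K} step steps) path = unclose-step {G = G} {K} short step (unclose short steps path)

-- Ears

record Ear {n} (G : Graph n) (S : Fin n → Bool) : Set where
  field
    start end first : Fin n
    inner           : List (Fin n)
    start∈S         : S start ≡ true
    end∈S           : S end ≡ true
    start≢end       : start ≢ end
    outside         : All (λ w → S w ≡ false) (first ∷ inner)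
    unique          : Unique (first ∷ inner)
    linked          : Linked (Adj G) (start ∷ first ∷ inner ++ [ end ])

walk⇒Ear : ∀ {n} {G : Graph n} {S x y d L} → S x ≡ true → S y ≡ true → x ≢ y →
  All (λ w → S w ≡ false) (d ∷ L) → Linked (Adj G) (x ∷ d ∷ L ++ [ y ]) → Ear G S
walk⇒Ear {S = S} {x} {y} {d} {L} Sx Sy x≢y (Sd ∷ outL) (x~d ∷ l)
  with L′ , l′ , u′ , L′⊆L ← Linked-shortcut _≟_ d L y (in≢out S Sy Sd ∘ sym) l = record
  { start = x ; end = y ; first = d ; inner = L′
  ; start∈S = Sx ; end∈S = Sy ; start≢end = x≢y
  ; outside = Sd ∷ Allₚ.anti-mono L′⊆L outL
  ; unique = Unique-++⁻ˡ (d ∷ L′) u′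
  ; linked = x~d ∷ l′
  }

-- From the outside vertex z walk towards c and stop at the first vertex x of S; then walk from z
-- inside G - x to another vertex of S and stop at the first vertex y of S. Reversing the first walk
-- and joining the two gives an x–y walk through z whose interior avoids S.
Ear-exists : ∀ {n} {G : Graph n} {S} → Connected G → (∀ v → ConnectedWithout G v) →
  ∀ {z c c′} → S z ≡ false → S c ≡ true → S c′ ≡ true → c ≢ c′ → Ear G S
Ear-exists {G = G} {S} connected noCut {z} {c} {c′} Sz Sc Sc′ c≢c′
  with mid₁ , l₁ ← connected z c (in≢out S Sc Sz ∘ sym)
  with pre₁ , x , Sx , _ , out₁ , z⇝x ← Linked-firstEntry S z mid₁ c Sc l₁
  with y₀ , Sy₀ , y₀≢x ← another _≟_ Sc Sc′ c≢c′ x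
  with mid₂ , avoid , l₂ ← noCut x z y₀ (in≢out S Sx Sz ∘ sym) y₀≢x (in≢out S Sy₀ Sz ∘ sym)
  with pre₂ , y , Sy , y∈ , out₂ , z⇝y ← Linked-firstEntry S z mid₂ y₀ Sy₀ l₂
  with d , L , eq ← ++-∷-nonEmpty (reverse pre₁) z pre₂ =
  walk⇒Ear {G = G} Sx Sy (λ x≡y → y≢x (sym x≡y))
    (subst (All (λ w → S w ≡ false)) eq (Allₚ.++⁺ (Allₚ.anti-mono (∈-resp-↭ (↭-reverse pre₁)) out₁) (Sz ∷ out₂)))
    (subst (λ t → Linked (Adj G) (x ∷ t ++ [ y ])) eq
      (subst (λ t → Linked (Adj G) (x ∷ t)) (sym (++-assoc (reverse pre₁) (z ∷ pre₂) [ y ]))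
        (Linked-glue (x ∷ reverse pre₁) (Linked-reverseWalk (Adj-sym G) pre₁ z⇝x) z⇝y)))
  where
  y≢x : y ≢ x
  y≢x with ∈-++⁻ mid₂ y∈
  ... | inj₁ y∈mid₂    = All.lookup avoid y∈mid₂
  ... | inj₂ (here refl) = y₀≢x

-- Closing an ear into a longer cycle

module _ {ℓ} {A : Set ℓ} where

  steps : A → List A → List (A × A)
  steps a []      = []
  steps a (b ∷ l) = (a , b) ∷ steps b l

  zip≡steps : ∀ a l b → zip (a ∷ l) (l ++ [ b ]) ≡ steps a (l ++ [ b ])
  zip≡steps a []      b = refl
  zip≡steps a (c ∷ l) b = cong ((a , c) ∷_) (zip≡steps c l b)

  steps-++ : ∀ a l b l′ → steps a (l ++ b ∷ l′) ≡ steps a (l ++ [ b ]) ++ steps b l′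
  steps-++ a []      b l′ = refl
  steps-++ a (c ∷ l) b l′ = cong ((a , c) ∷_) (steps-++ c l b l′)

module _ {n} (S : Fin n → Bool) where

  -- crossings (inV C) (cycleEdges K) unfolds to crossCount C K.
  crosses : Fin n × Fin n → Bool
  crosses (a , b) = S a xor S b

  crossings : List (Fin n × Fin n) → ℕ
  crossings es = countTrue {n} (map crosses es)

  crossings-++ : ∀ es fs → crossings (es ++ fs) ≡ crossings es + crossings fs
  crossings-++ es fs = trans (cong (countTrue {n}) (map-++ crosses es fs)) (countTrue-++ {n} (map crosses es) (map crosses fs))

  crossings-∷ : ∀ e es → crossings (e ∷ es) ≤ suc (crossings es)
  crossings-∷ (a , b) es with S a xor S b
  ... | true  = ≤-refl
  ... | false = n≤1+n _

  crossings-inside : ∀ {a l} → S a ≡ true → All (λ w → S w ≡ true) l → crossings (steps a l) ≡ 0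
  crossings-inside         Sa []         = refl
  crossings-inside {a} {b ∷ l} Sa (Sb ∷ Sl) rewrite Sa | Sb = crossings-inside Sb Sl

  crossings-outside : ∀ {a l} b → S a ≡ false → All (λ w → S w ≡ false) l → crossings (steps a (l ++ [ b ])) ≤ 1
  crossings-outside {a} {[]}    b Sa []        = crossings-∷ (a , b) []
  crossings-outside {a} {c ∷ l} b Sa (Sc ∷ Sl) rewrite Sa | Sc = crossings-outside b Sc Sl

Ear-closeCycle : ∀ {n} {G : Graph n} {S} (ear : Ear G S) → ∀ {P} → Ends (Ear.end ear) (Ear.start ear) P → HamPath G S P →
  ∃ λ K → IsCycle G K × length P < length K × crossings S (cycleEdges K) ≤ 2
Ear-closeCycle {n} {G} {S} ear {P} (mid , refl) (linkedP , uniqueP , spansP) =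
  K , (3≤length , uniqueK , linkedK) , longer , crossings≤2
  where
  open Ear ear
  K : List (Fin n)
  K = end ∷ mid ++ start ∷ first ∷ inner
  P++inner≡K : P ++ first ∷ inner ≡ K
  P++inner≡K = cong (end ∷_) (++-assoc mid [ start ] (first ∷ inner))
  uniqueK : Unique K
  uniqueK = subst Unique P++inner≡K (Unique.++⁺ uniqueP unique
    λ (w∈P , w∈inner) → not-¬ (to (spansP _) w∈P) (All.lookup outside w∈inner))
  linkedK : Linked (Adj G) (K ++ [ end ])
  linkedK = subst (λ t → Linked (Adj G) (end ∷ t)) (sym (++-assoc mid (start ∷ first ∷ inner) [ end ]))
    (Linked-glue (end ∷ mid) linkedP linked)
  longer : length P < length K
  longer = subst (length P <_) (trans (sym (+-suc (length P) (length inner))) (trans (sym (length-++ P)) (cong length P++inner≡K)))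
    (s≤s (m≤m+n (length P) (length inner)))
  3≤length : 3 ≤ length K
  3≤length = ≤-trans (s≤s (s≤s (subst (1 ≤_) (sym (length-++ mid)) (m≤n+m 1 (length mid))))) longer
  crossings≤2 : crossings S (cycleEdges K) ≤ 2
  crossings≤2 = begin
    crossings S (zip K ((mid ++ start ∷ first ∷ inner) ++ [ end ])) ≡⟨ cong (crossings S) (zip≡steps end (mid ++ start ∷ first ∷ inner) end) ⟩
    crossings S (steps end ((mid ++ start ∷ first ∷ inner) ++ [ end ]))
      ≡⟨ cong (crossings S ∘ steps end) (++-assoc mid (start ∷ first ∷ inner) [ end ]) ⟩
    crossings S (steps end (mid ++ start ∷ first ∷ inner ++ [ end ]))
      ≡⟨ cong (crossings S) (steps-++ end mid start (first ∷ inner ++ [ end ])) ⟩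
    crossings S (steps end (mid ++ [ start ]) ++ steps start (first ∷ inner ++ [ end ]))
      ≡⟨ crossings-++ S (steps end (mid ++ [ start ])) _ ⟩
    crossings S (steps end (mid ++ [ start ])) + crossings S (steps start (first ∷ inner ++ [ end ]))
      ≡⟨ cong (_+ _) (crossings-inside S end∈S (All.tabulate λ w∈ → to (spansP _) (there w∈))) ⟩
    crossings S ((start , first) ∷ steps first (inner ++ [ end ]))  ≤⟨ crossings-∷ S _ _ ⟩
    suc (crossings S (steps first (inner ++ [ end ])))               ≤⟨ s≤s (crossings-outside S end (All.head outside) (All.tail outside)) ⟩
    2                                                              ∎
    where open Data.Nat.Properties.≤-Reasoning hiding (start)

lemma2p6 : (n : ℕ) (G : Graph n) (C : List (Fin n)) → TwoConnected G →
    LocallyMaximal G C → length C ≤ n ∸ 1 →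
    (Gbar : Graph n) → IsCClosure G C Gbar →
    ¬ HamConnectedIn Gbar (inV C)
lemma2p6 n G C (3≤n , connected , noCutVertex) ((3≤c , uniqueC , _) , noLongerCycle) c≤n-1 Gbar (closure , _) hamConnected =
  let z , z∉C                       = outsideVertex C c<n
      c , c′ , c∈C , c′∈C , c≢c′   = twoDistinct (≤-trans (s≤s (s≤s z≤n)) 3≤c) uniqueC
      ear                           = Ear-exists connected noCutVertex z∉C (inV⁺ C c∈C) (inV⁺ C c′∈C) c≢c′
      P , ends , path               = unclose {G = G} {Gbar} spanning⇒shorter closure (hamPath-end⇝start ear)
      K , cycle , P<K , crossings≤2 = Ear-closeCycle ear ends path
  in  noLongerCycle (K , cycle , ≤-<-trans (C≤spanning (proj₂ path)) P<K , crossings≤2)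
  where
  c<n : length C < n
  c<n = ≤-<-trans c≤n-1 (∸-monoʳ-< z<s (≤-trans (s≤s z≤n) 3≤n))
  spanning⇒shorter : ∀ {P} → Spans (inV C) P → length P < suc (length C)
  spanning⇒shorter (uniqueP , spansP) = s≤s (length-mono-Unique uniqueP λ w∈P → inV⁻ C (to (spansP _) w∈P))
  C≤spanning : ∀ {P} → Spans (inV C) P → length C ≤ length P
  C≤spanning (_ , spansP) = length-mono-Unique uniqueC λ c∈C → from (spansP _) (inV⁺ C c∈C)
  hamPath-end⇝start : (ear : Ear G (inV C)) → HamPathBetween Gbar (inV C) (Ear.end ear) (Ear.start ear)
  hamPath-end⇝start ear with mid , uniqueP , linkedP , spansP ←
    hamConnected (Ear.end ear) (Ear.start ear) (Ear.end∈S ear) (Ear.start∈S ear) (Ear.start≢end ear ∘ sym) =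
    _ , (mid , refl) , linkedP , uniqueP , spansP
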